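{- Let $\mathcal{C}=\langle E,X\rangle$ be a stable configuration structure and $x^\dagger\in X$ a finite configuration. Define $\pi_{x^\dagger}:\mathsf{Pr}(\mathcal{C})\to\{ -1,1\}$ by $\pi_{x^\dagger}(p)=-1$ if $p\subseteq x^\dagger$ and $\pi_{x^\dagger}(p)=1$ otherwise. Then $\mathsf{E}(\mathcal{C})[\pi_{x^\dagger}]$ is a polarized event structure.
   Context: A configuration structure over a countable set $E$ is a pair $\langle E,X\rangle$ with $X\subseteq\mathcal{P}(E)$. It is stable if: $\emptyset\in X$; for every nonempty $x\in X$ there is $a\in x$ with $x\setminus\{a\}\in X$; for $x,y,z\in X$, $x\cup y\subseteq z$ implies $x\cup y\in X$; $x,y\in X$ implies $x\cap y\in X$; and for $x,y,z\in X$, if each of $x\cup y$, $y\cup z$, $x\cup z$ is contained in some element of $X$ then $x\cup y\cup z\in X$. In the poset $(X,\subseteq)$: a subset $Y$ is consistent if its least upper bound $\bigsqcup Y$ exists in $X$; $Y$ is pairwise consistent if $Y\neq\emptyset$ and every pair of distinct elements is consistent; an element $p$ is a complete prime if for every pairwise consistent $Y\subseteq X$ with $p\subseteq\bigsqcup Y$ there is $y\in Y$ with $p\subseteq y$. $\mathsf{Pr}(\mathcal{C})$ is the set of complete primes. Two configurations $x,y$ are compatible in $\mathcal{C}$ if $\bigsqcup\{x,y\}$ exists in $(X,\subseteq)$. A prime event structure is $(E,<,\#)$ with $<$ a partial order (causality) and $\#$ an irreflexive symmetric relation (conflict) such that $e\#e'<e''$ implies $e\# e''$; its configurations are the subsets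 of $E$ that are conflict-free and downward closed for $<$. $\mathsf{E}(\mathcal{C}):=(\mathsf{Pr}(\mathcal{C}),<,\#)$ with $p<q$ iff $p\subseteq q$ and $p\# q$ iff $p,q$ are not compatible in $\mathcal{C}$. A polarized event structure $\mathbb{E}[\pi]$ is a prime event structure $\mathbb{E}=(E,<,\#)$ with a map $\pi:E\to\{ -1,1\}$ such that $\{e\in E\mid\pi(e)<0\}$ is a configuration of $\mathbb{E}$. -}

module Defs where

open import Level using (Level; 0ℓ; _⊔_) renaming (suc to lsuc)
open import Data.Nat using (ℕ)
open import Data.Product using (Σ; ∃; _×_; _,_; proj₁)
open import Data.Sum using (_⊎_)
open import Data.List using (List)
open import Data.List.Membership.Propositional using () renaming (_∈_ to _∈ₗ_)
open import Data.Sign using (Sign)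
open import Relation.Nullary using (¬_)
open import Relation.Unary using (Pred; ∅; _⊆_; _≐_; _∪_; _∩_)
open import Relation.Binary.PropositionalEquality using (_≡_)
open import Function.Definitions using (Injective)
open import Function.Bundles using (_⇔_)

-- Subsets of E are predicates; a "set of subsets" is a predicate on them.

Cfg : Set → Set₁
Cfg E = Pred E 0ℓ

Countable : Set → Set
Countable E = ∃ λ (f : E → ℕ) → Injective _≡_ _≡_ f

FiniteSet : {E : Set} → Cfg E → Set
FiniteSet {E} x = ∃ λ (xs : List E) → ∀ e → x e → e ∈ₗ xs

_∖[_] : {E : Set} → Cfg E → E → Cfg E
(x ∖[ a ]) e = x e × ¬ (e ≡ a)

Extensional : {E : Set} → Pred (Cfg E) 0ℓ → Set₁
Extensional {E} X = ∀ (x y : Cfg E) → x ≐ y → X x → X y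

record IsStable {E : Set} (X : Pred (Cfg E) 0ℓ) : Set₁ where
  field
    empty     : X ∅
    coherent  : ∀ x → X x → (∃ λ e → x e) → ∃ λ a → x a × X (x ∖[ a ])
    stableUn  : ∀ x y z → X x → X y → X z → (x ∪ y) ⊆ z → X (x ∪ y)
    stableIn  : ∀ x y → X x → X y → X (x ∩ y)
    tripleUn  : ∀ x y z → X x → X y → X z →
                (∃ λ w → X w × (x ∪ y) ⊆ w) →
                (∃ λ w → X w × (y ∪ z) ⊆ w) →
                (∃ λ w → X w × (x ∪ z) ⊆ w) →
                X ((x ∪ y) ∪ z)

module _ {E : Set} (X : Pred (Cfg E) 0ℓ) where

  IsLub : Pred (Cfg E) 0ℓ → Cfg E → Set₁
  IsLub Y z = X z × (∀ y → Y y → y ⊆ z)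
                  × (∀ w → X w → (∀ y → Y y → y ⊆ w) → z ⊆ w)

  Consistent : Pred (Cfg E) 0ℓ → Set₁
  Consistent Y = ∃ λ z → IsLub Y z

  pair : Cfg E → Cfg E → Pred (Cfg E) 0ℓ
  pair x y w = (w ≐ x) ⊎ (w ≐ y)

  PairwiseConsistent : Pred (Cfg E) 0ℓ → Set₁
  PairwiseConsistent Y = (∃ λ y → Y y)
    × (∀ y y′ → Y y → Y y′ → ¬ (y ≐ y′) → Consistent (pair y y′))

  IsCompletePrime : Cfg E → Set₁
  IsCompletePrime p = X p ×
    (∀ (Y : Pred (Cfg E) 0ℓ) → Y ⊆ X → PairwiseConsistent Y →
       ∀ z → IsLub Y z → p ⊆ z → ∃ λ y → Y y × p ⊆ y)

  Pr : Set₁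
  Pr = Σ (Cfg E) IsCompletePrime

  Compatible : Cfg E → Cfg E → Set₁
  Compatible x y = Consistent (pair x y)

  _≈ᴱ_ : Pr → Pr → Set
  p ≈ᴱ q = proj₁ p ≐ proj₁ q

  _≤ᴱ_ : Pr → Pr → Set
  p ≤ᴱ q = proj₁ p ⊆ proj₁ q

  _#ᴱ_ : Pr → Pr → Set₁
  p #ᴱ q = ¬ Compatible (proj₁ p) (proj₁ q)

-- Prime event structures (causality as a reflexive partial order, up to
-- the equality ≈ of events) and polarized event structures.

module _ {a ℓ₁ ℓ₂ ℓ₃ : Level} {Ev : Set a}
         (_≈_ : Ev → Ev → Set ℓ₁) (_≤_ : Ev → Ev → Set ℓ₂)
         (_#_ : Ev → Ev → Set ℓ₃) where

  record IsPrimeES : Set (a ⊔ ℓ₁ ⊔ ℓ₂ ⊔ ℓ₃) where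
    field
      ≤-refl    : ∀ e → e ≤ e
      ≤-trans   : ∀ e e′ e″ → e ≤ e′ → e′ ≤ e″ → e ≤ e″
      ≤-antisym : ∀ e e′ → e ≤ e′ → e′ ≤ e → e ≈ e′
      #-irrefl  : ∀ e → ¬ (e # e)
      #-sym     : ∀ e e′ → e # e′ → e′ # e
      #-hered   : ∀ e e′ e″ → e # e′ → e′ ≤ e″ → e # e″

  IsConfiguration : ∀ {ℓ} → Pred Ev ℓ → Set (a ⊔ ℓ ⊔ ℓ₂ ⊔ ℓ₃)
  IsConfiguration S = (∀ e e′ → S e → S e′ → ¬ (e # e′))
                    × (∀ e e′ → e′ ≤ e → S e → S e′)

  IsPolarizedES : (Ev → Sign) → Set (a ⊔ ℓ₁ ⊔ ℓ₂ ⊔ ℓ₃)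
  IsPolarizedES π = IsPrimeES × IsConfiguration (λ e → π e ≡ Sign.-)

{-# OPTIONS --safe #-}
module Submission where

-- In a stable configuration structure two configurations are compatible exactly when
-- some configuration contains both: the union is then a configuration by stability and
-- is their least upper bound. Containment in a common configuration is symmetric,
-- reflexive, inherited by smaller sets, and holds for any two primes below x†; this
-- gives the conflict axioms of E(C) and the conflict-freeness of the negative events.

open import Defs
open import Level using (Level; 0ℓ)
open import Relation.Unary using (Pred; _⊆_; _≐_; _∪_)
open import Relation.Binary.PropositionalEquality using (_≡_)
open import Data.Product using (∃; _×_; proj₁; _,_)
open import Data.Sum using (inj₁; inj₂; [_,_])
open import Data.Sign using (Sign)
open import Function.Base using (id; _∘_)
open import Function.Bundles using (_⇔_; Equivalence)

module _ {E : Set} (X : Pred (Cfg E) 0ℓ) where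

  Bounded : Cfg E → Cfg E → Set₁
  Bounded x y = ∃ λ z → X z × (x ∪ y) ⊆ z

  ∪-isLub-pair : ∀ {x y} → X (x ∪ y) → IsLub X (pair X x y) (x ∪ y)
  ∪-isLub-pair {x} {y} X[x∪y] = X[x∪y] , upper , least
    where
    upper : ∀ w → pair X x y w → w ⊆ x ∪ y
    upper w (inj₁ (w⊆x , _)) = inj₁ ∘ w⊆x
    upper w (inj₂ (w⊆y , _)) = inj₂ ∘ w⊆y
    least : ∀ w → X w → (∀ v → pair X x y v → v ⊆ w) → x ∪ y ⊆ w
    least w _ upper-w = [ upper-w x (inj₁ (id , id)) , upper-w y (inj₂ (id , id)) ]

  compatible⇒bounded : ∀ {x y} → Compatible X x y → Bounded x y
  compatible⇒bounded {x} {y} (z , Xz , upper , _) =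
    z , Xz , [ upper x (inj₁ (id , id)) , upper y (inj₂ (id , id)) ]

  bounded⇒compatible : IsStable X → ∀ {x y} → X x → X y → Bounded x y → Compatible X x y
  bounded⇒compatible st {x} {y} Xx Xy (z , Xz , x∪y⊆z) =
    x ∪ y , ∪-isLub-pair (IsStable.stableUn st x y z Xx Xy Xz x∪y⊆z)

  bounded-sym : ∀ {x y} → Bounded x y → Bounded y x
  bounded-sym (z , Xz , x∪y⊆z) = z , Xz , [ x∪y⊆z ∘ inj₂ , x∪y⊆z ∘ inj₁ ]

  bounded-antitoneʳ : ∀ {x y y′} → y′ ⊆ y → Bounded x y → Bounded x y′
  bounded-antitoneʳ y′⊆y (z , Xz , x∪y⊆z) = z , Xz , [ x∪y⊆z ∘ inj₁ , x∪y⊆z ∘ inj₂ ∘ y′⊆y ]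

  bounded-below : ∀ {x y z} → X z → x ⊆ z → y ⊆ z → Bounded x y
  bounded-below Xz x⊆z y⊆z = _ , Xz , [ x⊆z , y⊆z ]

module _ {a ℓ₁ ℓ₂ ℓ₃ ℓ : Level} {Ev : Set a}
         {_≈_ : Ev → Ev → Set ℓ₁} {_≤_ : Ev → Ev → Set ℓ₂} {_#_ : Ev → Ev → Set ℓ₃} where

  isConfiguration-resp-≐ : {S T : Pred Ev ℓ} → S ≐ T →
                           IsConfiguration _≈_ _≤_ _#_ S → IsConfiguration _≈_ _≤_ _#_ T
  isConfiguration-resp-≐ (S⊆T , T⊆S) (conflict-free , down-closed) =
    (λ e e′ Te Te′ → conflict-free e e′ (T⊆S Te) (T⊆S Te′)) ,
    (λ e e′ e′≤e Te → S⊆T (down-closed e e′ e′≤e (T⊆S Te)))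

module _ {E : Set} {X : Pred (Cfg E) 0ℓ} (st : IsStable X) where

  compatibleᴱ : ∀ (p q : Pr X) → Bounded X (proj₁ p) (proj₁ q) → Compatible X (proj₁ p) (proj₁ q)
  compatibleᴱ (_ , Xp , _) (_ , Xq , _) = bounded⇒compatible X st Xp Xq

  E-isPrimeES : IsPrimeES (_≈ᴱ_ X) (_≤ᴱ_ X) (_#ᴱ_ X)
  E-isPrimeES = record
    { ≤-refl    = λ _ → id
    ; ≤-trans   = λ _ _ _ p≤q q≤r → q≤r ∘ p≤q
    ; ≤-antisym = λ _ _ → _,_
    ; #-irrefl  = λ { p@(_ , Xp , _) p#p → p#p (compatibleᴱ p p (bounded-below X Xp id id)) }
    ; #-sym     = λ p q p#q q~p →
        p#q (compatibleᴱ p q (bounded-sym X (compatible⇒bounded X q~p)))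
    ; #-hered   = λ p q r p#q q≤r p~r →
        p#q (compatibleᴱ p q (bounded-antitoneʳ X q≤r (compatible⇒bounded X p~r)))
    }

  primesBelow-isConfiguration : ∀ {x} → X x →
    IsConfiguration (_≈ᴱ_ X) (_≤ᴱ_ X) (_#ᴱ_ X) (λ p → proj₁ p ⊆ x)
  primesBelow-isConfiguration Xx =
    (λ p q p⊆x q⊆x p#q → p#q (compatibleᴱ p q (bounded-below X Xx p⊆x q⊆x))) ,
    (λ p q q≤p p⊆x → p⊆x ∘ q≤p)

mainTheorem6 : (E : Set) (X : Pred (Cfg E) 0ℓ) → Countable E → Extensional X → IsStable X →
    (x† : Cfg E) → X x† → FiniteSet x† →
    (π : Pr X → Sign) → (∀ p → (π p ≡ Sign.-) ⇔ (proj₁ p ⊆ x†)) →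
    IsPolarizedES (_≈ᴱ_ X) (_≤ᴱ_ X) (_#ᴱ_ X) π
mainTheorem6 E X _ _ st x† Xx† _ π negative⇔below =
  E-isPrimeES st ,
  isConfiguration-resp-≐ {_≈_ = _≈ᴱ_ X} ((λ {p} → Equivalence.from (negative⇔below p)) ,
                                            (λ {p} → Equivalence.to (negative⇔below p)))
                                           (primesBelow-isConfiguration st Xx†)
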